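{- For any two integers $k$ and $\ell$ with $2\leq k\leq \ell$, there exists a connected graph $G$ with $\gamma_{\rm MB}(G)=k$ and $\gamma_{\rm MBT}(G)=\ell$.
   Context: All graphs are finite and simple. In both the Maker-Breaker domination (MBD) game and the Maker-Breaker total domination (MBTD) game on $G$, two players, Dominator and Staller, alternately select previously unselected vertices of $G$. In the MBD game Dominator wins if his selected vertices contain a dominating set of $G$ (a set $D$ such that every vertex outside $D$ has a neighbor in $D$); in the MBTD game he wins if they contain a total dominating set of $G$ (a set $D$ such that every vertex of $G$ has a neighbor in $D$); otherwise Staller wins. In the D-game Dominator moves first. $\gamma_{\rm MB}(G)$ (resp. $\gamma_{\rm MBT}(G)$) is the minimum number of moves Dominator needs to win the MBD (resp. MBTD) D-game under optimal play (Dominator trying to win as fast as possible, Staller trying to prevent or delay his win), and is $\infty$ if Dominator has no winning strategy. -}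

module Defs where

open import Data.Nat using (ℕ; zero; suc; _<_)
open import Data.Fin using (Fin)
open import Data.Fin.Properties using (_≟_)
open import Data.Bool using (Bool; true; false)
open import Data.Product using (Σ; ∃; _×_; _,_)
open import Data.Sum using (_⊎_)
open import Data.Empty using (⊥)
open import Relation.Nullary using (¬_; yes; no)
open import Relation.Binary.PropositionalEquality using (_≡_)

record Graph : Set where
  field
    n      : ℕ
    adj    : Fin n → Fin n → Bool
    sym    : ∀ u v → adj u v ≡ adj v u
    irrefl : ∀ u → adj u u ≡ false
open Graph public

data Walk (G : Graph) : Fin (n G) → Fin (n G) → Set where
  here : ∀ {u} → Walk G u u
  step : ∀ {u v w} → adj G u v ≡ true → Walk G v w → Walk G u w

Connected : Graph → Set
Connected G = ∀ u v → Walk G u v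

data Owner : Set where
  free dom stal : Owner

State : Graph → Set
State G = Fin (n G) → Owner

initial : (G : Graph) → State G
initial G _ = free

update : (G : Graph) → State G → Fin (n G) → Owner → State G
update G s v o u with u ≟ v
... | yes _ = o
... | no  _ = s u

Dominated : (G : Graph) → State G → Set
Dominated G s = ∀ u → (s u ≡ dom) ⊎ (∃ λ w → (adj G u w ≡ true) × (s w ≡ dom))

TotallyDominated : (G : Graph) → State G → Set
TotallyDominated G s = ∀ u → ∃ λ w → (adj G u w ≡ true) × (s w ≡ dom)

-- DomWinsIn G Win k s : it is Dominator's turn in position s (where he has
-- not yet won), and Dominator can force his win condition Win within at most
-- k further moves of his, whatever Staller does.  If after a Dominator move
-- he has not won and no vertex is free, the game ends and Staller wins.
DomWinsIn : (G : Graph) → (State G → Set) → ℕ → State G → Set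
DomWinsIn G Win zero s = ⊥
DomWinsIn G Win (suc k) s =
  ∃ λ v → (s v ≡ free) ×
    ( Win (update G s v dom)
    ⊎ ( (∃ λ w → update G s v dom w ≡ free)
      × (∀ w → update G s v dom w ≡ free →
           DomWinsIn G Win k (update G (update G s v dom) w stal))))

GameNumberIs : (G : Graph) → (State G → Set) → ℕ → Set
GameNumberIs G Win k =
  DomWinsIn G Win k (initial G) × (∀ m → m < k → ¬ DomWinsIn G Win m (initial G))

γMB≡ : Graph → ℕ → Set
γMB≡ G k = GameNumberIs G (Dominated G) k

γMBT≡ : Graph → ℕ → Set
γMBT≡ G k = GameNumberIs G (TotallyDominated G) k

-- The graph has a vertex P pendant at S, a vertex C adjacent to S, and m = r + q gadgets:
-- a centre X u with twins Y false u and Y true u, the twins being adjacent to S and C, and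
-- X u adjacent to C exactly for the first r ≥ 1 gadgets.
--
-- Both upper bounds are pairing strategies.  In the domination game Dominator opens at C and
-- then answers Staller inside the pairs {P, S} and the twins of the q gadgets not attached
-- to C; in the total domination game he opens at S and pairs the twins of all m gadgets.
-- Both lower bounds count pairwise disjoint vertex lists that every winning position must
-- hit, since one Dominator move hits at most one of them and Staller's moves hit none: the
-- closed neighbourhoods of P, X 0 and the unattached X u for domination, and for total
-- domination the twin pairs of all gadgets, once Dominator has opened at S and Staller has
-- replied at C (any other opening loses S, the only neighbour of P, to Staller).
-- This gives γ_MB = q + 2 and γ_MBT = m + 1 = r + q + 1.

module Submission where

open import Defs renaming (sym to adj-sym)
open import Data.Nat using (ℕ; _≤_; zero; suc; _+_; _∸_; z≤n; s≤s)
open import Data.Nat.Properties using (<⇒≱; m∸n+n≡m)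
open import Data.Product using (Σ; _×_; ∃; ∃₂; _,_; proj₁; proj₂; swap)
open import Data.Sum using (_⊎_; inj₁; inj₂; [_,_]′)
open import Data.Bool using (Bool; true; false; not; _∨_)
open import Data.Bool.Properties using (∨-comm; not-¬)
open import Data.Fin using (Fin; zero; suc; punchIn; punchOut; _↑ˡ_; _↑ʳ_; splitAt)
open import Data.Fin.Properties
  using (_≟_; any?; punchIn-injective; punchInᵢ≢i; punchIn-punchOut; ↑ʳ-injective;
         splitAt-↑ˡ; splitAt-↑ʳ; splitAt⁻¹-↑ˡ; splitAt⁻¹-↑ʳ)
open import Data.List using (List; []; _∷_)
open import Data.List.Relation.Unary.Any using (Any; here; there)
open import Data.List.Membership.Propositional using (_∈_; _∉_; find; lose)
open import Data.Empty using (⊥-elim)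
open import Data.Unit using (⊤; tt)
open import Function using (_∘_; _∘₂_; case_of_)
open import Relation.Nullary using (¬_; yes; no; Dec; does)
open import Relation.Nullary.Decidable using (dec-true)
open import Relation.Binary.PropositionalEquality
  using (_≡_; _≢_; refl; sym; trans; cong; subst)

all-punchIn : ∀ {t} {P : Fin (suc t) → Set} u → P u → (∀ i → P (punchIn u i)) → ∀ j → P j
all-punchIn {P = P} u Pu P-rest j with u ≟ j
... | yes refl = Pu
... | no u≢j   = subst P (punchIn-punchOut u≢j) (P-rest (punchOut u≢j))

¬Fin⇒≤ : ∀ {t j} → ¬ Fin t → t ≤ j
¬Fin⇒≤ {zero}  _    = z≤n
¬Fin⇒≤ {suc t} ¬Fin = ⊥-elim (¬Fin zero)

dom≢free : dom ≢ free
dom≢free ()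

stal≢free : stal ≢ free
stal≢free ()

stal≢dom : stal ≢ dom
stal≢dom ()

module Walks (G : Graph) where

  _++ʷ_ : ∀ {u v w} → Walk G u v → Walk G v w → Walk G u w
  here     ++ʷ q = q
  step e p ++ʷ q = step e (p ++ʷ q)

  reverseʷ : ∀ {u v} → Walk G u v → Walk G v u
  reverseʷ here       = here
  reverseʷ (step e p) = reverseʷ p ++ʷ step (trans (adj-sym G _ _) e) here

  connected-via-hub : ∀ h → (∀ u → Walk G u h) → Connected G
  connected-via-hub h to-hub u v = to-hub u ++ʷ reverseʷ (to-hub v)

module Game (G : Graph) where

  V : Set
  V = Fin (n G)

  open import Data.List.Membership.DecPropositional (_≟_ {n G}) using (_∈?_)

  update-same : ∀ s v o → update G s v o v ≡ o
  update-same s v o with v ≟ v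
  ... | yes _   = refl
  ... | no v≢v = ⊥-elim (v≢v refl)

  update-other : ∀ s v o u → u ≢ v → update G s v o u ≡ s u
  update-other s v o u u≢v with u ≟ v
  ... | yes u≡v = ⊥-elim (u≢v u≡v)
  ... | no _    = refl

  update-keeps : ∀ s v o u → s v ≡ free → s u ≢ free → update G s v o u ≡ s u
  update-keeps s v o u v-free u-taken = update-other s v o u λ { refl → u-taken v-free }

  _⊑_ : State G → State G → Set
  s ⊑ s′ = ∀ x → s x ≡ dom → s′ x ≡ dom

  ⊑-trans : ∀ {s₁ s₂ s₃} → s₁ ⊑ s₂ → s₂ ⊑ s₃ → s₁ ⊑ s₃
  ⊑-trans s₁⊑s₂ s₂⊑s₃ x = s₂⊑s₃ x ∘ s₁⊑s₂ x

  ⊑-update : ∀ s v o → s v ≡ free → s ⊑ update G s v o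
  ⊑-update s v o v-free x x-dom =
    trans (update-keeps s v o x v-free λ e → dom≢free (trans (sym x-dom) e)) x-dom

  stal-update-⊑ : ∀ s w → update G s w stal ⊑ s
  stal-update-⊑ s w x x-dom with x ≟ w
  stal-update-⊑ s w x ()    | yes _
  ... | no _ = x-dom

  game-number : ∀ {Win k} → DomWinsIn G Win k (initial G) →
                (∀ {j} → DomWinsIn G Win j (initial G) → k ≤ j) → GameNumberIs G Win k
  game-number win lower = win , λ j j<k win-j → <⇒≱ j<k (lower win-j)

  one-move-not-total : ∀ v → ¬ TotallyDominated G (update G (initial G) v dom)
  one-move-not-total v tds with tds v
  ... | w , v~w , w-dom with w ≟ v
  ...   | yes refl = not-¬ (irrefl G v) v~w
  ...   | no _     = dom≢free (sym w-dom)

  Persistent : (State G → Set) → Set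
  Persistent Q = ∀ s v o → s v ≡ free → Q s → Q (update G s v o)

  stal-persistent : ∀ x → Persistent (λ s → s x ≡ stal)
  stal-persistent x s v o v-free x-stal =
    trans (update-keeps s v o x v-free λ e → stal≢free (trans (sym x-stal) e)) x-stal

  never-wins : ∀ {Win Q : State G → Set} → Persistent Q → (∀ s → Q s → ¬ Win s) →
               ∀ {j s} → Q s → ¬ DomWinsIn G Win j s
  never-wins Q-pers lost {suc j} {s} q (v , v-free , inj₁ win) =
    lost _ (Q-pers s v dom v-free q) win
  never-wins Q-pers lost {suc j} {s} q (v , v-free , inj₂ ((w , w-free) , staller)) =
    never-wins Q-pers lost (Q-pers _ w stal w-free (Q-pers s v dom v-free q)) (staller w w-free)

  Hits : State G → List V → Set
  Hits s L = Any (λ x → s x ≡ dom) L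

  hits-mono : ∀ {s s′ L} → (∀ {x} → x ∈ L → s x ≡ dom → s′ x ≡ dom) →
              Hits s L → Hits s′ L
  hits-mono mono h with find h
  ... | x , x∈L , x-dom = lose x∈L (mono x∈L x-dom)

  free-¬hits : ∀ {s L} → (∀ {x} → x ∈ L → s x ≡ free) → ¬ Hits s L
  free-¬hits all-free h with find h
  ... | x , x∈L , x-dom = dom≢free (trans (sym x-dom) (all-free x∈L))

  dominated-hits : ∀ {s L} x → Dominated G s → x ∈ L →
                   (∀ {y} → adj G x y ≡ true → s y ≡ dom → y ∈ L) → Hits s L
  dominated-hits x ds x∈L closed with ds x
  ... | inj₁ x-dom             = lose x∈L x-dom
  ... | inj₂ (y , x~y , y-dom) = lose (closed x~y y-dom) y-dom

  totally-dominated-hits : ∀ {s L} x → TotallyDominated G s →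
                           (∀ {y} → adj G x y ≡ true → s y ≡ dom → y ∈ L) → Hits s L
  totally-dominated-hits x tds open-nbhd with tds x
  ... | y , x~y , y-dom = lose (open-nbhd x~y y-dom) y-dom

  PairwiseDisjoint : ∀ {t} → (Fin t → List V) → Set
  PairwiseDisjoint E = ∀ {x i j} → x ∈ E i → x ∈ E j → i ≡ j

  keyed⇒disjoint : ∀ {t} {E : Fin t → List V} (key : V → Fin t) →
                   (∀ i {x} → x ∈ E i → key x ≡ i) → PairwiseDisjoint E
  keyed⇒disjoint key keyed {i = i} {j} x∈Ei x∈Ej = trans (sym (keyed i x∈Ei)) (keyed j x∈Ej)

  only-member-of : ∀ {t} (E : Fin (suc t) → List V) → PairwiseDisjoint E →
                   ∀ v → ∃ λ k → ∀ i → i ≢ k → v ∉ E i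
  only-member-of E disjoint v with any? (λ i → v ∈? E i)
  ... | yes (k , v∈Ek) = k , λ i i≢k v∈Ei → i≢k (disjoint v∈Ei v∈Ek)
  ... | no v∉E         = zero , λ i _ v∈Ei → v∉E (i , v∈Ei)

  punchIn-disjoint : ∀ {t} {E : Fin (suc t) → List V} k → PairwiseDisjoint E →
                     PairwiseDisjoint (E ∘ punchIn k)
  punchIn-disjoint k disjoint {i = i} {i′} x∈Ei x∈Ei′ =
    punchIn-injective k i i′ (disjoint x∈Ei x∈Ei′)

  move-hits-at-most-one : ∀ {t} (E : Fin (suc t) → List V) → PairwiseDisjoint E → ∀ {s} v →
                          (∀ i → ¬ Hits s (E i)) →
                          ∃ λ k → ∀ i → ¬ Hits (update G s v dom) (E (punchIn k i))
  move-hits-at-most-one E disjoint {s} v unhit with only-member-of E disjoint v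
  ... | k , v∉others = k , λ i → unhit (punchIn k i) ∘ hits-mono λ {x} x∈E x-dom →
    trans (sym (update-other s v dom x λ { refl → v∉others _ (punchInᵢ≢i k i) x∈E })) x-dom

  hitting-lower-bound :
    ∀ {Win Q : State G → Set} → Persistent Q →
    ∀ {t} (E : Fin t → List V) → PairwiseDisjoint E →
    (∀ s → Q s → Win s → ∀ i → Hits s (E i)) →
    ∀ {j s} → Q s → (∀ i → ¬ Hits s (E i)) → DomWinsIn G Win j s → t ≤ j
  hitting-lower-bound Q-pers {zero} E disjoint win-hits q unhit win = z≤n
  hitting-lower-bound Q-pers {suc t} E disjoint win-hits {suc j} {s} q unhit (v , v-free , next)
    with move-hits-at-most-one E disjoint v unhit | next
  ... | k , unhit₁ | inj₁ win =
    s≤s (¬Fin⇒≤ λ i → unhit₁ i (win-hits _ (Q-pers s v dom v-free q) win (punchIn k i)))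
  ... | k , unhit₁ | inj₂ ((w , w-free) , staller) =
    s≤s (hitting-lower-bound Q-pers (E ∘ punchIn k) (punchIn-disjoint k disjoint)
          (λ s′ q′ win → win-hits s′ q′ win ∘ punchIn k)
          (Q-pers _ w stal w-free (Q-pers s v dom v-free q))
          (λ i → unhit₁ i ∘ hits-mono (λ {x} _ → stal-update-⊑ (update G s v dom) w x))
          (staller w w-free))

  PairsInjective : ∀ {t} → (Fin t → Bool → V) → Set
  PairsInjective pair = ∀ {i j a b} → pair i a ≡ pair j b → i ≡ j × a ≡ b

  punchIn-pairs-injective : ∀ {t} {pair : Fin (suc t) → Bool → V} u → PairsInjective pair →
                           PairsInjective (pair ∘ punchIn u)
  punchIn-pairs-injective u inj e with inj e
  ... | i≡j , a≡b = punchIn-injective u _ _ i≡j , a≡b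

  Claimed : ∀ {t} → State G → (Fin t → Bool → V) → Fin t → Set
  Claimed s pair i = ∃ λ b → s (pair i b) ≡ dom

  counter-move : ∀ {t} (pair : Fin (suc t) → Bool → V) → PairsInjective pair → ∀ w →
                 ∃₂ λ u b → pair u b ≢ w × (∀ i c → i ≢ u → pair i c ≢ w)
  counter-move pair inj w with any? side?
    where
    side? : ∀ u → Dec (∃ λ b → pair u b ≡ w)
    side? u with pair u false ≟ w | pair u true ≟ w
    ... | yes e | _     = yes (false , e)
    ... | no _  | yes e = yes (true , e)
    ... | no f  | no t  = no λ { (false , e) → f e ; (true , e) → t e }
  ... | yes (u , b , e) = u , not b , (λ e′ → not-¬ refl (sym (proj₂ (inj (trans e′ (sym e))))))
                                    , λ i c i≢u e′ → i≢u (proj₁ (inj (trans e′ (sym e))))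
  ... | no w∉pairs      = zero , false , (λ e → w∉pairs (zero , false , e))
                                       , λ i c _ e → w∉pairs (i , c , e)

  module _ {Win : State G → Set} where

    -- Stated for all later states s′, so that it survives dropping pairs once they are claimed.
    Sufficient : ∀ {t} → State G → (Fin t → Bool → V) → Set
    Sufficient s pair = ∀ s′ → s ⊑ s′ → (∀ i → Claimed s′ pair i) → Win s′

    claim-then-pair : ∀ {t} s y (pair : Fin t → Bool → V) → PairsInjective pair → s y ≡ free →
                      (∀ i b → update G s y dom (pair i b) ≡ free) →
                      Sufficient (update G s y dom) pair → DomWinsIn G Win (suc t) s
    claim-then-pair {zero} s y pair inj y-free all-free suff =
      y , y-free , inj₁ (suff _ (λ _ x-dom → x-dom) λ ())
    claim-then-pair {suc t} s y pair inj y-free all-free suff =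
      y , y-free , inj₂ ((pair zero false , all-free zero false) , respond)
      where
      s₁ : State G
      s₁ = update G s y dom
      respond : ∀ w → s₁ w ≡ free → DomWinsIn G Win (suc t) (update G s₁ w stal)
      respond w w-free with counter-move pair inj w
      ... | u , b , y′≢w , others≢w =
        claim-then-pair s₂ y′ (pair ∘ punchIn u) (punchIn-pairs-injective u inj)
          y′-free all-free′ suff′
        where
        s₂ : State G
        s₂ = update G s₁ w stal
        y′ : V
        y′ = pair u b
        s₃ : State G
        s₃ = update G s₂ y′ dom
        y′-free : s₂ y′ ≡ free
        y′-free = trans (update-other s₁ w stal y′ y′≢w) (all-free u b)
        all-free′ : ∀ i c → s₃ (pair (punchIn u i) c) ≡ free
        all-free′ i c = let x = pair (punchIn u i) c in
          trans (update-other s₂ y′ dom x (punchInᵢ≢i u i ∘ proj₁ ∘ inj))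
            (trans (update-other s₁ w stal x (others≢w (punchIn u i) c (punchInᵢ≢i u i)))
              (all-free (punchIn u i) c))
        suff′ : Sufficient s₃ (pair ∘ punchIn u)
        suff′ s′ s₃⊑s′ claimed =
          suff s′ (⊑-trans (⊑-trans (⊑-update s₁ w stal w-free) (⊑-update s₂ y′ dom y′-free))
                           s₃⊑s′)
            (all-punchIn u (b , s₃⊑s′ y′ (update-same s₂ y′ dom)) claimed)

    pairing-strategy : ∀ {t} s c (pair : Fin t → Bool → V) → PairsInjective pair →
                       s c ≡ free → (∀ i b → s (pair i b) ≡ free) → (∀ i b → pair i b ≢ c) →
                       (∀ s′ → s′ c ≡ dom → (∀ i → Claimed s′ pair i) → Win s′) →
                       DomWinsIn G Win (suc t) s
    pairing-strategy s c pair inj c-free all-free pair≢c win =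
      claim-then-pair s c pair inj c-free
        (λ i b → trans (update-other s c dom (pair i b) (pair≢c i b)) (all-free i b))
        (λ s′ s₁⊑s′ → win s′ (s₁⊑s′ c (update-same s c dom)))

module EncodedGraph {A : Set} {N : ℕ} (enc : A → Fin N) (dec : Fin N → A)
  (dec-enc : ∀ a → dec (enc a) ≡ a) (enc-dec : ∀ x → enc (dec x) ≡ x)
  (adjacent : A → A → Bool) (adjacent-sym : ∀ a b → adjacent a b ≡ adjacent b a)
  (adjacent-irrefl : ∀ a → adjacent a a ≡ false) where

  graph : Graph
  graph = record
    { n      = N
    ; adj    = λ x y → adjacent (dec x) (dec y)
    ; sym    = λ x y → adjacent-sym (dec x) (dec y)
    ; irrefl = adjacent-irrefl ∘ dec
    }

  enc-injective : ∀ {a b} → enc a ≡ enc b → a ≡ b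
  enc-injective {a} {b} e = trans (sym (dec-enc a)) (trans (cong dec e) (dec-enc b))

  edge : ∀ a b → adjacent a b ≡ true → adj graph (enc a) (enc b) ≡ true
  edge a b a~b rewrite dec-enc a | dec-enc b = a~b

  neighbour : ∀ a {y} → adj graph (enc a) y ≡ true → ∃ λ b → y ≡ enc b × adjacent a b ≡ true
  neighbour a {y} a~y =
    dec y , sym (enc-dec y) , subst (λ a′ → adjacent a′ (dec y) ≡ true) (dec-enc a) a~y

  all-enc : ∀ {P : Fin N → Set} → (∀ a → P (enc a)) → ∀ x → P x
  all-enc {P} P-enc x = subst P (enc-dec x) (P-enc (dec x))

module Construction (d q : ℕ) where

  r m : ℕ
  r = suc d
  m = r + q

  data Vertex : Set where
    P S C : Vertex
    X     : Fin m → Vertex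
    Y     : Bool → Fin m → Vertex

  attached? : Fin m → Bool
  attached? u = [ (λ _ → true) , (λ _ → false) ]′ (splitAt r u)

  attached?-↑ˡ : ∀ i → attached? (i ↑ˡ q) ≡ true
  attached?-↑ˡ i rewrite splitAt-↑ˡ r i q = refl

  attached?-↑ʳ : ∀ j → attached? (r ↑ʳ j) ≡ false
  attached?-↑ʳ j rewrite splitAt-↑ʳ r q j = refl

  data Attachment : Fin m → Set where
    attached : ∀ i → Attachment (i ↑ˡ q)
    detached : ∀ j → Attachment (r ↑ʳ j)

  attachment : ∀ u → Attachment u
  attachment u with splitAt r u in eq
  ... | inj₁ i = subst Attachment (splitAt⁻¹-↑ˡ eq) (attached i)
  ... | inj₂ j = subst Attachment (splitAt⁻¹-↑ʳ eq) (detached j)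

  arc : Vertex → Vertex → Bool
  arc P     S       = true
  arc S     C       = true
  arc S     (Y _ _) = true
  arc C     (X u)   = attached? u
  arc C     (Y _ _) = true
  arc (X u) (Y _ v) = does (u ≟ v)
  arc _     _       = false

  adjacent : Vertex → Vertex → Bool
  adjacent a b = arc a b ∨ arc b a

  adjacent-irrefl : ∀ a → adjacent a a ≡ false
  adjacent-irrefl P       = refl
  adjacent-irrefl S       = refl
  adjacent-irrefl C       = refl
  adjacent-irrefl (X _)   = refl
  adjacent-irrefl (Y _ _) = refl

  X~Y : ∀ u b → adjacent (X u) (Y b u) ≡ true
  X~Y u b = cong (_∨ false) (dec-true (u ≟ u) refl)

  N : ℕ
  N = 3 + (m + (m + m))

  enc : Vertex → Fin N
  enc P           = zero
  enc S           = suc zero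
  enc C           = suc (suc zero)
  enc (X u)       = 3 ↑ʳ (u ↑ˡ (m + m))
  enc (Y false u) = 3 ↑ʳ (m ↑ʳ (u ↑ˡ m))
  enc (Y true u)  = 3 ↑ʳ (m ↑ʳ (m ↑ʳ u))

  dec : Fin N → Vertex
  dec zero                = P
  dec (suc zero)          = S
  dec (suc (suc zero))    = C
  dec (suc (suc (suc x))) = [ X , [ Y false , Y true ]′ ∘ splitAt m ]′ (splitAt m x)

  dec-enc : ∀ a → dec (enc a) ≡ a
  dec-enc P = refl
  dec-enc S = refl
  dec-enc C = refl
  dec-enc (X u)       rewrite splitAt-↑ˡ m u (m + m) = refl
  dec-enc (Y false u) rewrite splitAt-↑ʳ m (m + m) (u ↑ˡ m) | splitAt-↑ˡ m u m = refl
  dec-enc (Y true u)  rewrite splitAt-↑ʳ m (m + m) (m ↑ʳ u) | splitAt-↑ʳ m m u = refl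

  enc-dec : ∀ x → enc (dec x) ≡ x
  enc-dec zero             = refl
  enc-dec (suc zero)       = refl
  enc-dec (suc (suc zero)) = refl
  enc-dec (suc (suc (suc x))) with splitAt m x in eq
  ... | inj₁ u = cong (3 ↑ʳ_) (splitAt⁻¹-↑ˡ eq)
  ... | inj₂ y with splitAt m y in eq′
  ...   | inj₁ u = cong (3 ↑ʳ_) (trans (cong (m ↑ʳ_) (splitAt⁻¹-↑ˡ eq′)) (splitAt⁻¹-↑ʳ eq))
  ...   | inj₂ u = cong (3 ↑ʳ_) (trans (cong (m ↑ʳ_) (splitAt⁻¹-↑ʳ eq′)) (splitAt⁻¹-↑ʳ eq))

  open EncodedGraph enc dec dec-enc enc-dec
         adjacent (λ a b → ∨-comm (arc a b) (arc b a)) adjacent-irrefl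

  G : Graph
  G = graph

  open Walks G
  open Game G

  to-S : ∀ a → Walk G (enc a) (enc S)
  to-S P       = step (edge P S refl) here
  to-S S       = here
  to-S C       = step (edge C S refl) here
  to-S (X u)   = step (edge (X u) (Y false u) (X~Y u false)) (to-S (Y false u))
  to-S (Y b u) = step (edge (Y b u) S refl) here

  connected : Connected G
  connected = connected-via-hub (enc S) (all-enc to-S)

  twins : Fin m → List (Fin N)
  twins u = enc (Y false u) ∷ enc (Y true u) ∷ []

  twin-∈ : ∀ b u → enc (Y b u) ∈ twins u
  twin-∈ false u = here refl
  twin-∈ true  u = there (here refl)

  P-neighbours : ∀ {y} → adj G (enc P) y ≡ true → y ≡ enc S
  P-neighbours {y} P~y with neighbour P {y} P~y
  ... | S     , refl , _ = refl
  ... | P     , _ , ()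
  ... | C     , _ , ()
  ... | X _   , _ , ()
  ... | Y _ _ , _ , ()

  X-neighbours : ∀ {u y} → adj G (enc (X u)) y ≡ true →
                 (y ≡ enc C × attached? u ≡ true) ⊎ y ∈ twins u
  X-neighbours {u} {y} X~y with neighbour (X u) {y} X~y
  ... | C     , refl , att = inj₁ (refl , att)
  ... | Y b v , refl , X~Yv with u ≟ v
  ...   | yes refl = inj₂ (twin-∈ b u)
  ...   | no _ with X~Yv
  ...     | ()
  X-neighbours {u} {y} X~y | P   , _ , ()
  X-neighbours {u} {y} X~y | S   , _ , ()
  X-neighbours {u} {y} X~y | X _ , _ , ()

  dominated-via : ∀ (s : State G) a b → adjacent a b ≡ true → s (enc b) ≡ dom →
                  ∃ λ w → adj G (enc a) w ≡ true × s w ≡ dom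
  dominated-via s a b a~b b-dom = enc b , edge a b a~b , b-dom

  Y-injective : ∀ {a b u v} → Y a u ≡ Y b v → a ≡ b × u ≡ v
  Y-injective refl = refl , refl

  mb-pair : Fin (suc q) → Bool → Vertex
  mb-pair zero    false = P
  mb-pair zero    true  = S
  mb-pair (suc j) b     = Y b (r ↑ʳ j)

  mb-pair-injective : ∀ {i j a b} → mb-pair i a ≡ mb-pair j b → i ≡ j × a ≡ b
  mb-pair-injective {zero}  {zero}  {false} {false} _ = refl , refl
  mb-pair-injective {zero}  {zero}  {true}  {true}  _ = refl , refl
  mb-pair-injective {suc i} {suc j} e with Y-injective e
  ... | a≡b , u≡v = cong suc (↑ʳ-injective r i j u≡v) , a≡b
  mb-pair-injective {zero}  {zero}  {false} {true}  ()
  mb-pair-injective {zero}  {zero}  {true}  {false} ()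
  mb-pair-injective {zero}  {suc _} {false} ()
  mb-pair-injective {zero}  {suc _} {true}  ()
  mb-pair-injective {suc _} {zero}  {_} {false} ()
  mb-pair-injective {suc _} {zero}  {_} {true}  ()

  mb-pair≢C : ∀ i b → mb-pair i b ≢ C
  mb-pair≢C zero    false ()
  mb-pair≢C zero    true  ()
  mb-pair≢C (suc j) b     ()

  mb-sufficient : ∀ s → s (enc C) ≡ dom → (∀ i → Claimed s (enc ∘₂ mb-pair) i) →
                  Dominated G s
  mb-sufficient s C-dom claimed = all-enc covered
    where
    covered : ∀ a → s (enc a) ≡ dom ⊎ ∃ λ w → adj G (enc a) w ≡ true × s w ≡ dom
    covered P with claimed zero
    ... | false , P-dom = inj₁ P-dom
    ... | true  , S-dom = inj₂ (dominated-via s P S refl S-dom)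
    covered S = inj₂ (dominated-via s S C refl C-dom)
    covered C = inj₁ C-dom
    covered (X u) with attachment u
    ... | attached i = inj₂ (dominated-via s (X (i ↑ˡ q)) C (attached?-↑ˡ i) C-dom)
    ... | detached j with claimed (suc j)
    ...   | b , Y-dom = inj₂ (dominated-via s (X (r ↑ʳ j)) (Y b (r ↑ʳ j)) (X~Y (r ↑ʳ j) b) Y-dom)
    covered (Y b u) = inj₂ (dominated-via s (Y b u) C refl C-dom)

  mb-upper : DomWinsIn G (Dominated G) (suc (suc q)) (initial G)
  mb-upper =
    pairing-strategy (initial G) (enc C) (enc ∘₂ mb-pair) (mb-pair-injective ∘ enc-injective)
    refl (λ _ _ → refl) (λ i b → mb-pair≢C i b ∘ enc-injective) mb-sufficient

  closed-nbhds : Fin (suc (suc q)) → List (Fin N)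
  closed-nbhds zero          = enc P ∷ enc S ∷ []
  closed-nbhds (suc zero)    = enc (X zero) ∷ enc C ∷ twins zero
  closed-nbhds (suc (suc j)) = enc (X (r ↑ʳ j)) ∷ twins (r ↑ʳ j)

  gadget-key : Fin m → Fin (suc (suc q))
  gadget-key u = [ (λ _ → suc zero) , (λ j → suc (suc j)) ]′ (splitAt r u)

  gadget-key-↑ʳ : ∀ j → gadget-key (r ↑ʳ j) ≡ suc (suc j)
  gadget-key-↑ʳ j rewrite splitAt-↑ʳ r q j = refl

  mb-key : Vertex → Fin (suc (suc q))
  mb-key (X u)   = gadget-key u
  mb-key (Y _ u) = gadget-key u
  mb-key C       = suc zero
  mb-key _       = zero

  mb-key-enc : ∀ a → mb-key (dec (enc a)) ≡ mb-key a
  mb-key-enc a = cong mb-key (dec-enc a)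

  mb-keyed : ∀ i {x} → x ∈ closed-nbhds i → mb-key (dec x) ≡ i
  mb-keyed zero          (here refl)                         = refl
  mb-keyed zero          (there (here refl))                 = refl
  mb-keyed (suc zero)    (here refl)                         = refl
  mb-keyed (suc zero)    (there (here refl))                 = refl
  mb-keyed (suc zero)    (there (there (here refl)))         = mb-key-enc (Y false zero)
  mb-keyed (suc zero)    (there (there (there (here refl)))) = mb-key-enc (Y true zero)
  mb-keyed (suc (suc j)) (here refl) =
    trans (mb-key-enc (X (r ↑ʳ j))) (gadget-key-↑ʳ j)
  mb-keyed (suc (suc j)) (there (here refl)) =
    trans (mb-key-enc (Y false (r ↑ʳ j))) (gadget-key-↑ʳ j)
  mb-keyed (suc (suc j)) (there (there (here refl))) =
    trans (mb-key-enc (Y true (r ↑ʳ j))) (gadget-key-↑ʳ j)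

  mb-win-hits : ∀ s → Dominated G s → ∀ i → Hits s (closed-nbhds i)
  mb-win-hits s ds zero = dominated-hits (enc P) ds (here refl) λ P~y _ →
    subst (_∈ closed-nbhds zero) (sym (P-neighbours P~y)) (there (here refl))
  mb-win-hits s ds (suc zero) =
    dominated-hits (enc (X zero)) ds (here refl) λ X~y _ → closed (X-neighbours X~y)
    where
    closed : ∀ {y} → (y ≡ enc C × attached? zero ≡ true) ⊎ y ∈ twins zero →
             y ∈ closed-nbhds (suc zero)
    closed (inj₁ (refl , _)) = there (here refl)
    closed (inj₂ y∈twins)    = there (there y∈twins)
  mb-win-hits s ds (suc (suc j)) =
    dominated-hits (enc (X (r ↑ʳ j))) ds (here refl) λ X~y _ → closed (X-neighbours X~y)
    where
    closed : ∀ {y} → (y ≡ enc C × attached? (r ↑ʳ j) ≡ true) ⊎ y ∈ twins (r ↑ʳ j) →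
             y ∈ closed-nbhds (suc (suc j))
    closed (inj₁ (_ , att)) = ⊥-elim (not-¬ (attached?-↑ʳ j) att)
    closed (inj₂ y∈twins)   = there y∈twins

  mb-lower : ∀ {j} → DomWinsIn G (Dominated G) j (initial G) → suc (suc q) ≤ j
  mb-lower = hitting-lower-bound {Q = λ _ → ⊤} (λ _ _ _ _ _ → tt) closed-nbhds
    (keyed⇒disjoint (mb-key ∘ dec) mb-keyed) (λ s _ → mb-win-hits s)
    tt (λ _ → free-¬hits λ _ → refl)

  td-pair : Fin m → Bool → Fin N
  td-pair u b = enc (Y b u)

  td-pair-injective : PairsInjective td-pair
  td-pair-injective e = swap (Y-injective (enc-injective e))

  td-sufficient : ∀ s → s (enc S) ≡ dom → (∀ u → Claimed s td-pair u) → TotallyDominated G s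
  td-sufficient s S-dom claimed = all-enc covered
    where
    covered : ∀ a → ∃ λ w → adj G (enc a) w ≡ true × s w ≡ dom
    covered P = dominated-via s P S refl S-dom
    covered S with claimed zero
    ... | b , Y-dom = dominated-via s S (Y b zero) refl Y-dom
    covered C = dominated-via s C S refl S-dom
    covered (X u) with claimed u
    ... | b , Y-dom = dominated-via s (X u) (Y b u) (X~Y u b) Y-dom
    covered (Y b u) = dominated-via s (Y b u) S refl S-dom

  td-upper : DomWinsIn G (TotallyDominated G) (suc m) (initial G)
  td-upper = pairing-strategy (initial G) (enc S) td-pair td-pair-injective
    refl (λ _ _ → refl) (λ u b e → case enc-injective {Y b u} {S} e of λ ()) td-sufficient

  td-key : Vertex → Fin m
  td-key (Y _ u) = u
  td-key _       = zero

  td-keyed : ∀ u {x} → x ∈ twins u → td-key (dec x) ≡ u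
  td-keyed u (here refl)         = cong td-key (dec-enc (Y false u))
  td-keyed u (there (here refl)) = cong td-key (dec-enc (Y true u))

  td-win-hits : ∀ s → s (enc C) ≡ stal → TotallyDominated G s → ∀ u → Hits s (twins u)
  td-win-hits s C-stal tds u =
    totally-dominated-hits (enc (X u)) tds λ X~y → dominating (X-neighbours X~y)
    where
    dominating : ∀ {y} → (y ≡ enc C × attached? u ≡ true) ⊎ y ∈ twins u → s y ≡ dom → y ∈ twins u
    dominating (inj₁ (refl , _)) C-dom = ⊥-elim (stal≢dom (trans (sym C-stal) C-dom))
    dominating (inj₂ y∈twins)    _     = y∈twins

  S-needed : ∀ s → s (enc S) ≡ stal → ¬ TotallyDominated G s
  S-needed s S-stal tds with tds (enc P)
  ... | y , P~y , y-dom =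
    stal≢dom (trans (sym S-stal) (subst (λ y → s y ≡ dom) (P-neighbours P~y) y-dom))

  td-lower : ∀ {j} → DomWinsIn G (TotallyDominated G) j (initial G) → suc m ≤ j
  td-lower {suc j} (v , _ , inj₁ win) = ⊥-elim (one-move-not-total v win)
  td-lower {suc j} (v , _ , inj₂ (_ , staller)) with v ≟ enc S
  ... | yes refl = s≤s (hitting-lower-bound (stal-persistent (enc C)) twins
                          (keyed⇒disjoint (td-key ∘ dec) td-keyed) td-win-hits
                          (update-same s₁ (enc C) stal) (λ u → free-¬hits (twins-free u))
                          (staller (enc C) refl))
    where
    s₁ : State G
    s₁ = update G (initial G) (enc S) dom
    twins-free : ∀ u {x} → x ∈ twins u → update G s₁ (enc C) stal x ≡ free
    twins-free u (here refl)         = refl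
    twins-free u (there (here refl)) = refl
  ... | no v≢S = ⊥-elim (never-wins (stal-persistent (enc S)) S-needed (update-same s₁ (enc S) stal)
                          (staller (enc S) (update-other (initial G) v dom (enc S) (v≢S ∘ sym))))
    where
    s₁ : State G
    s₁ = update G (initial G) v dom

  mb-number : γMB≡ G (suc (suc q))
  mb-number = game-number mb-upper mb-lower

  td-number : γMBT≡ G (suc (suc (d + q)))
  td-number = game-number td-upper td-lower

theorem3p1 : (k ℓ : ℕ) → 2 ≤ k → k ≤ ℓ →
    Σ Graph (λ G → Connected G × γMB≡ G k × γMBT≡ G ℓ)
theorem3p1 (suc (suc q)) (suc (suc ℓ)) (s≤s (s≤s z≤n)) (s≤s (s≤s q≤ℓ))
  with ℓ ∸ q | m∸n+n≡m q≤ℓ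
... | d | refl = G , connected , mb-number , td-number
  where open Construction d q
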